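{- Let $q$ be a prime power and $A\in\mathbb{F}_q^*$. Then the polynomial $$f_3(x)=x+A x^{q^2-q+1}+A^2x^{q^2}$$ is a permutation polynomial of $\mathbb{F}_{q^3}$ if and only if $A^3\neq 1$. Moreover, if $f_3$ is a permutation polynomial of $\mathbb{F}_{q^3}$, then its compositional inverse is $$f_3^{ -1}(x)=\big(A^2x+x^q+Ax^{q^2}\big)^{q^3-2}\,x^{q+1}.$$
   Context: $\mathbb{F}_q$ denotes the finite field with $q$ elements. A polynomial $f\in\mathbb{F}_{q^3}[x]$ is a permutation polynomial of $\mathbb{F}_{q^3}$ if the map $c\mapsto f(c)$ is a bijection of $\mathbb{F}_{q^3}$; its compositional inverse $f^{ -1}$ is the unique polynomial (modulo $x^{q^3}-x$) with $f(f^{ -1}(x))\equiv f^{ -1}(f(x))\equiv x \pmod{x^{q^3}-x}$, i.e. the inverse map on $\mathbb{F}_{q^3}$. -}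

module Defs where

open import Level using (Level; _⊔_)
open import Data.Nat using (ℕ; _∸_; _≥_)
import Data.Nat as ℕ
open import Data.Nat.Primality using (Prime)
open import Data.Fin using (Fin)
open import Data.Product using (Σ; ∃; ∃-syntax; _×_; _,_)
open import Relation.Nullary using (¬_)
open import Relation.Binary.PropositionalEquality using (_≡_)
open import Algebra.Bundles using (CommutativeRing)

IsPrimePower : ℕ → Set
IsPrimePower q = Σ ℕ λ p → Σ ℕ λ k → Prime p × k ≥ 1 × q ≡ p ℕ.^ k

module _ {c ℓ : Level} (R : CommutativeRing c ℓ) where
  open CommutativeRing R
  open import Algebra.Bundles using (Semiring)
  import Algebra.Definitions.RawSemiring as RS

  _^_ : Carrier → ℕ → Carrier
  _^_ = RS._^_ (Semiring.rawSemiring semiring)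

  IsField : Set (c ⊔ ℓ)
  IsField = (¬ (0# ≈ 1#)) × (∀ x → ¬ (x ≈ 0#) → ∃[ y ] (x * y ≈ 1#))

  HasCardinality : ℕ → Set (c ⊔ ℓ)
  HasCardinality n = Σ (Fin n → Carrier) λ e →
    (∀ i j → e i ≈ e j → i ≡ j) × (∀ x → ∃[ i ] (e i ≈ x))

  IsFiniteFieldOfOrder : ℕ → Set (c ⊔ ℓ)
  IsFiniteFieldOfOrder n = IsField × HasCardinality n

  IsPermutation : (Carrier → Carrier) → Set (c ⊔ ℓ)
  IsPermutation f = (∀ x y → f x ≈ f y → x ≈ y) × (∀ y → ∃[ x ] (f x ≈ y))

  IsInverse : (Carrier → Carrier) → (Carrier → Carrier) → Set (c ⊔ ℓ)
  IsInverse f g = (∀ x → f (g x) ≈ x) × (∀ x → g (f x) ≈ x)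

  f₃ : ℕ → Carrier → Carrier → Carrier
  f₃ q A x = x + A * (x ^ ((q ℕ.* q ∸ q) ℕ.+ 1)) + (A ^ 2) * (x ^ (q ℕ.* q))

  g₃ : ℕ → Carrier → Carrier → Carrier
  g₃ q A x = ((A ^ 2) * x + x ^ q + A * (x ^ (q ℕ.* q))) ^ (q ℕ.^ 3 ∸ 2) * (x ^ (q ℕ.+ 1))

{-# OPTIONS --safe #-}
module Submission where

-- Let σ x = x ^ q. By the Frobenius and Fermat identities σ is a ring automorphism of order 3,
-- and it fixes A. With S(a,b,c) = ab + A ac + A² bc one has f₃(x) σx = S(x,σx,σ²x), and a
-- polynomial identity between the three rotations of S yields, for x ≠ 0,
--   f₃(x) σ(f₃(x)) = x L(f₃(x)),   L(y) = A² y + σy + A σ²y.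
-- So when f₃(x) ≠ 0 also L(f₃(x)) ≠ 0, and g₃(f₃(x)) = L^{q³-2} f₃(x)^{q+1} = x L^{q³-1} = x.
-- A nonzero root x of f₃ makes both S(x,σx,σ²x) and S(σx,σ²x,x) vanish, which forces A³ = 1.
-- Conversely, if A³ = 1 then u = σw - Aw satisfies A² u + A σu + σ²u = 0, so 1/u is a nonzero
-- root of f₃ whenever σw ≠ Aw; such a w exists because X^q - X has at most q < q³ roots.

open import Defs hiding (_^_)
open import Level using (Level; _⊔_)
open import Data.Nat using (ℕ; zero; suc; _<_; _≤_; _∸_; _!; z≤n; s≤s)
import Data.Nat as ℕ
import Data.Nat.Properties as ℕₚ
open import Data.Nat.Divisibility using (_∣_; _∤_; divides; ∣⇒≤; m∣m*n)
open import Data.Nat.Primality using (Prime; euclidsLemma; prime⇒nonZero; prime⇒nonTrivial)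
open import Data.Nat.Combinatorics using (_C_; nCn≡1; k![n∸k]!∣n!)
open import Data.Nat.Combinatorics.Specification using (nCk≡n!/k![n-k]!)
open import Data.Nat.DivMod using (m/n*n≡m)
open import Data.Fin as Fin using (Fin; punchIn; punchOut)
import Data.Fin.Properties as Finₚ
open import Data.Fin.Permutation using (Permutation; permutation; _⟨$⟩ʳ_)
open import Data.Vec using (Vec; []; _∷_; replicate)
open import Data.Product using (_×_; _,_; proj₁; proj₂; Σ; ∃; ∃-syntax; map)
open import Data.Sum using (inj₁; inj₂)
open import Relation.Nullary using (¬_; Dec; yes; no; contradiction)
open import Relation.Unary using (Pred; Decidable)
open import Relation.Binary.Definitions using (_Respects_)
open import Data.Unit using (⊤; tt)
open import Relation.Binary.PropositionalEquality as ≡ using (_≡_; _≢_)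
open import Relation.Binary.Bundles using (Setoid)
open import Function using (_∘_; id)
open import Algebra.Bundles using (CommutativeRing; CommutativeSemiring; CommutativeMonoid)

prime∤m! : ∀ {p} → Prime p → ∀ m → m < p → p ∤ m !
prime∤m! p-prime zero    _   p∣1 =
  ℕₚ.<⇒≱ (ℕ.nonTrivial⇒n>1 _ {{prime⇒nonTrivial p-prime}}) (∣⇒≤ p∣1)
prime∤m! p-prime (suc m) m<p p∣m! with euclidsLemma (suc m) (m !) p-prime p∣m!
... | inj₁ p∣1+m = ℕₚ.<⇒≱ m<p (∣⇒≤ p∣1+m)
... | inj₂ p∣m!′ = prime∤m! p-prime m (ℕₚ.<-trans (ℕₚ.n<1+n m) m<p) p∣m!′

nCk*k![n∸k]!≡n! : ∀ {n k} → k ≤ n → (n C k) ℕ.* (k ! ℕ.* (n ∸ k) !) ≡ n !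
nCk*k![n∸k]!≡n! {n} {k} k≤n =
  ≡.trans (≡.cong (λ m → m ℕ.* (k ! ℕ.* (n ∸ k) !)) (nCk≡n!/k![n-k]! k≤n)) (m/n*n≡m (k![n∸k]!∣n! k≤n))
  where
  instance
    k![n∸k]!≢0 : ℕ.NonZero (k ! ℕ.* (n ∸ k) !)
    k![n∸k]!≢0 = k ℕₚ.!* (n ∸ k) !≢0

n∣n! : ∀ n → .{{ℕ.NonZero n}} → n ∣ n !
n∣n! (suc n) = m∣m*n (n !)

prime∣pCk : ∀ {p k} → Prime p → 0 < k → k < p → p ∣ p C k
prime∣pCk {p} {k} p-prime 0<k k<p
  with euclidsLemma (p C k) (k ! ℕ.* (p ∸ k) !) p-prime p∣pCk*k![p∸k]!
  where
  p∣pCk*k![p∸k]! : p ∣ (p C k) ℕ.* (k ! ℕ.* (p ∸ k) !)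
  p∣pCk*k![p∸k]! =
    ≡.subst (p ∣_) (≡.sym (nCk*k![n∸k]!≡n! (ℕₚ.<⇒≤ k<p))) (n∣n! p {{prime⇒nonZero p-prime}})
... | inj₁ p∣pCk = p∣pCk
... | inj₂ p∣k!*[p∸k]! with euclidsLemma (k !) ((p ∸ k) !) p-prime p∣k!*[p∸k]!
...   | inj₁ p∣k!     = contradiction p∣k! (prime∤m! p-prime k k<p)
...   | inj₂ p∣[p∸k]! =
  contradiction p∣[p∸k]! (prime∤m! p-prime (p ∸ k) (ℕₚ.∸-monoʳ-< 0<k (ℕₚ.<⇒≤ k<p)))

module _ {a ℓ} (S : Setoid a ℓ) where
  open Setoid S

  record IsEnumerationOf {d} (D : Pred Carrier d) {n} (E : Fin n → Carrier) : Set (a ⊔ ℓ ⊔ d) where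
    field
      injective : ∀ i j → E i ≈ E j → i ≡ j
      into      : ∀ i → D (E i)
      onto      : ∀ x → D x → ∃[ i ] E i ≈ x

  record IsBijectionOn {d} (D : Pred Carrier d) (φ ψ : Carrier → Carrier) : Set (a ⊔ ℓ ⊔ d) where
    field
      φ-cong : ∀ {x y} → x ≈ y → φ x ≈ φ y
      ψ-cong : ∀ {x y} → x ≈ y → ψ x ≈ ψ y
      φ-into : ∀ {x} → D x → D (φ x)
      ψ-into : ∀ {x} → D x → D (ψ x)
      ψ∘φ    : ∀ {x} → D x → ψ (φ x) ≈ x
      φ∘ψ    : ∀ {x} → D x → φ (ψ x) ≈ x

  enumeration-reindexing : ∀ {d} {D : Pred Carrier d} {n} {E : Fin n → Carrier} {φ ψ} →
    IsEnumerationOf D E → IsBijectionOn D φ ψ →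
    Σ (Permutation n n) λ π → ∀ i → E (π ⟨$⟩ʳ i) ≈ φ (E i)
  enumeration-reindexing {E = E} {φ} {ψ} enum bij =
    permutation to from
      (λ i → injective _ _ (trans (E[to]≈φE (from i)) (trans (φ-cong (E[from]≈ψE i)) (φ∘ψ (into i)))))
      (λ i → injective _ _ (trans (E[from]≈ψE (to i)) (trans (ψ-cong (E[to]≈φE i)) (ψ∘φ (into i)))))
    , E[to]≈φE
    where
    open IsEnumerationOf enum
    open IsBijectionOn bij
    to from : Fin _ → Fin _
    to i = proj₁ (onto (φ (E i)) (φ-into (into i)))
    from i = proj₁ (onto (ψ (E i)) (ψ-into (into i)))
    E[to]≈φE : ∀ i → E (to i) ≈ φ (E i)
    E[to]≈φE i = proj₂ (onto (φ (E i)) (φ-into (into i)))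
    E[from]≈ψE : ∀ i → E (from i) ≈ ψ (E i)
    E[from]≈ψE i = proj₂ (onto (ψ (E i)) (ψ-into (into i)))

  TotalEnumeration : ℕ → Set (a ⊔ ℓ)
  TotalEnumeration n = Σ (Fin n → Carrier) (IsEnumerationOf (λ _ → ⊤))

  remove-from-enumeration : ∀ {n} → TotalEnumeration (suc n) → ∀ z →
    Σ (Fin n → Carrier) (IsEnumerationOf (λ x → ¬ x ≈ z))
  remove-from-enumeration (E , enum) z = E ∘ punchIn i₀ , record
    { injective = λ i j E′i≈E′j → Finₚ.punchIn-injective i₀ i j (injective _ _ E′i≈E′j)
    ; into      = λ j E′j≈z → Finₚ.punchInᵢ≢i i₀ j (injective _ _ (trans E′j≈z (sym Ei₀≈z)))
    ; onto      = onto′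
    }
    where
    open IsEnumerationOf enum
    i₀ : Fin (suc _)
    i₀ = proj₁ (onto z tt)
    Ei₀≈z : E i₀ ≈ z
    Ei₀≈z = proj₂ (onto z tt)
    onto′ : ∀ x → ¬ x ≈ z → ∃[ j ] E (punchIn i₀ j) ≈ x
    onto′ x x≉z = punchOut i₀≢i , trans (reflexive (≡.cong E (Finₚ.punchIn-punchOut i₀≢i))) Ei≈x
      where
      i : Fin (suc _)
      i = proj₁ (onto x tt)
      Ei≈x : E i ≈ x
      Ei≈x = proj₂ (onto x tt)
      i₀≢i : i₀ ≢ i
      i₀≢i i₀≡i = x≉z (trans (sym Ei≈x) (trans (reflexive (≡.cong E (≡.sym i₀≡i))) Ei₀≈z))

Fin-injective⇒surjective : ∀ {n} (h : Fin n → Fin n) → (∀ {i j} → h i ≡ h j → i ≡ j) →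
                           ∀ j → ∃[ i ] h i ≡ j
Fin-injective⇒surjective {suc n} h h-injective j with Finₚ.any? (λ i → h i Finₚ.≟ j)
... | yes hit = hit
... | no  miss = contradiction (Finₚ.injective⇒≤ h′-injective) ℕₚ.1+n≰n
  where
  h′ : Fin (suc n) → Fin n
  h′ i = punchOut {i = j} (λ j≡hi → miss (i , ≡.sym j≡hi))
  h′-injective : ∀ {i i′} → h′ i ≡ h′ i′ → i ≡ i′
  h′-injective {i} {i′} eq = h-injective (Finₚ.punchOut-injective {i = j} {j = h i} {k = h i′} _ _ eq)

module _ {a ℓ} (M : CommutativeMonoid a ℓ) where
  open CommutativeMonoid M
  open import Algebra.Properties.CommutativeMonoid.Sum M
  open import Relation.Binary.Reasoning.Setoid setoid

  sum≈last : ∀ {n} (t : Fin (suc n) → Carrier) → (∀ i → t (Fin.inject₁ i) ≈ ε) → sum t ≈ t (Fin.fromℕ n)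
  sum≈last {n} t init≈0 = begin
    sum t                                  ≈⟨ sum-init-last t ⟩
    sum (t ∘ Fin.inject₁) ∙ t (Fin.fromℕ n) ≈⟨ ∙-congʳ (trans (sum-cong-≋ init≈0) (sum-replicate-zero n)) ⟩
    ε ∙ t (Fin.fromℕ n)                    ≈⟨ identityˡ _ ⟩
    t (Fin.fromℕ n)                        ∎

  sum-invariant-under-bijection : ∀ {d} {D : Pred Carrier d} {n} {E : Fin n → Carrier} {φ ψ} →
    IsEnumerationOf setoid D E → IsBijectionOn setoid D φ ψ → sum E ≈ sum (φ ∘ E)
  sum-invariant-under-bijection {E = E} enum bij =
    let π , E∘π≈φ∘E = enumeration-reindexing setoid enum bij in trans (sum-permute E π) (sum-cong-≋ E∘π≈φ∘E)

module Frobenius {a ℓ} (S : CommutativeSemiring a ℓ) where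
  open CommutativeSemiring S
  open import Algebra.Properties.Semiring.Mult semiring renaming (_×_ to _·_)
  open import Algebra.Properties.Semiring.Exp semiring
  open import Algebra.Properties.Semiring.Sum semiring using (sum)
  open import Algebra.Properties.CommutativeSemiring.Binomial S
    using (binomialTerm) renaming (theorem to binomial-theorem)
  open import Relation.Binary.Reasoning.Setoid setoid

  m·1≈0⇒m·x≈0 : ∀ m x → m · 1# ≈ 0# → m · x ≈ 0#
  m·1≈0⇒m·x≈0 m x m·1≈0 = begin
    m · x        ≈⟨ ×-congʳ m (sym (*-identityˡ x)) ⟩
    m · (1# * x) ≈⟨ ×-assoc-* m 1# x ⟨
    (m · 1#) * x ≈⟨ *-congʳ m·1≈0 ⟩
    0# * x       ≈⟨ zeroˡ x ⟩
    0#           ∎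

  freshmans-dream : ∀ n → .{{ℕ.NonZero n}} → (∀ {k} → 0 < k → k < n → (n C k) · 1# ≈ 0#) →
                    ∀ x y → (x + y) ^ n ≈ x ^ n + y ^ n
  freshmans-dream (suc n) middle≈0 x y = begin
    (x + y) ^ suc n                    ≈⟨ binomial-theorem (suc n) x y ⟩
    t Fin.zero + sum (t ∘ Fin.suc)     ≈⟨ +-congˡ (sum≈last +-commutativeMonoid (t ∘ Fin.suc) middle-term≈0) ⟩
    t Fin.zero + t (Fin.fromℕ (suc n)) ≈⟨ +-comm _ _ ⟩
    t (Fin.fromℕ (suc n)) + t Fin.zero ≈⟨ +-cong last-term≈x^n first-term≈y^n ⟩
    x ^ suc n + y ^ suc n              ∎
    where
    t : Fin (suc (suc n)) → Carrier
    t = binomialTerm x y (suc n)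
    middle-term≈0 : ∀ i → t (Fin.suc (Fin.inject₁ i)) ≈ 0#
    middle-term≈0 i = m·1≈0⇒m·x≈0 (suc n C suc (Fin.toℕ (Fin.inject₁ i))) _ (middle≈0 (s≤s z≤n) (s≤s k<n))
      where
      k<n : Fin.toℕ (Fin.inject₁ i) < n
      k<n = ≡.subst (_< n) (≡.sym (Finₚ.toℕ-inject₁ i)) (Finₚ.toℕ<n i)
    first-term≈y^n : t Fin.zero ≈ y ^ suc n
    first-term≈y^n = trans (+-identityʳ _) (*-identityˡ _)
    last-term≈x^n : t (Fin.fromℕ (suc n)) ≈ x ^ suc n
    last-term≈x^n = begin
      t (Fin.fromℕ (suc n))
        ≡⟨ ≡.cong (λ k → (suc n C k) · (x ^ k * y ^ (suc n ∸ k))) (Finₚ.toℕ-fromℕ (suc n)) ⟩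
      (suc n C suc n) · (x ^ suc n * y ^ (suc n ∸ suc n))
        ≡⟨ ≡.cong₂ (λ c e → c · (x ^ suc n * y ^ e)) (nCn≡1 (suc n)) (ℕₚ.n∸n≡0 n) ⟩
      1 · (x ^ suc n * 1#)
        ≈⟨ trans (+-identityʳ _) (*-identityʳ _) ⟩
      x ^ suc n ∎

  module _ {p} (p-prime : Prime p) (p·1≈0 : p · 1# ≈ 0#) where

    p∣m⇒m·1≈0 : ∀ {m} → p ∣ m → m · 1# ≈ 0#
    p∣m⇒m·1≈0 (divides d ≡.refl) = begin
      (d ℕ.* p) · 1#       ≈⟨ ×1-homo-* d p ⟩
      (d · 1#) * (p · 1#) ≈⟨ *-congˡ p·1≈0 ⟩
      (d · 1#) * 0#       ≈⟨ zeroʳ _ ⟩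
      0#                  ∎

    ^p-distrib-+ : ∀ x y → (x + y) ^ p ≈ x ^ p + y ^ p
    ^p-distrib-+ = freshmans-dream p {{prime⇒nonZero p-prime}}
      (λ 0<k k<p → p∣m⇒m·1≈0 (prime∣pCk p-prime 0<k k<p))

    ^[p^k]-distrib-+ : ∀ k x y → (x + y) ^ (p ℕ.^ k) ≈ x ^ (p ℕ.^ k) + y ^ (p ℕ.^ k)
    ^[p^k]-distrib-+ zero    x y = trans (*-identityʳ _) (sym (+-cong (*-identityʳ x) (*-identityʳ y)))
    ^[p^k]-distrib-+ (suc k) x y = begin
      (x + y) ^ (p ℕ.* p ℕ.^ k)               ≈⟨ ^-assocʳ (x + y) p (p ℕ.^ k) ⟨
      ((x + y) ^ p) ^ (p ℕ.^ k)               ≈⟨ ^-congˡ (p ℕ.^ k) (^p-distrib-+ x y) ⟩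
      (x ^ p + y ^ p) ^ (p ℕ.^ k)             ≈⟨ ^[p^k]-distrib-+ k _ _ ⟩
      (x ^ p) ^ (p ℕ.^ k) + (y ^ p) ^ (p ℕ.^ k) ≈⟨ +-cong (^-assocʳ x p (p ℕ.^ k)) (^-assocʳ y p (p ℕ.^ k)) ⟩
      x ^ (p ℕ.* p ℕ.^ k) + y ^ (p ℕ.* p ℕ.^ k) ∎

module Field {c ℓ} (R : CommutativeRing c ℓ) (isField : IsField R) where
  open CommutativeRing R
  open import Algebra.Properties.Ring ring using (x∙y⁻¹≈ε⇒x≈y; x≈y⇒x∙y⁻¹≈ε; -‿distribˡ-*; +-cancelˡ)
  open import Algebra.Properties.Semiring.Exp semiring
  open import Algebra.Properties.Semiring.Mult semiring using (×1-homo-*) renaming (_×_ to _·_)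
  open import Algebra.Properties.CommutativeMonoid.Sum +-commutativeMonoid using (sum; ∑-distrib-+; sum-replicate)
  open import Algebra.Properties.CommutativeMonoid.Sum *-commutativeMonoid using ()
    renaming (sum to product; ∑-distrib-+ to ∏-distrib-*; sum-replicate to product-replicate)
  open import Algebra.Solver.Ring.NaturalCoefficients.Default commutativeSemiring
  open import Relation.Binary.Reasoning.Setoid setoid

  0≉1 : ¬ 0# ≈ 1#
  0≉1 = proj₁ isField

  inverse : ∀ x → ¬ x ≈ 0# → Carrier
  inverse x x≉0 = proj₁ (proj₂ isField x x≉0)

  *-inverseʳ : ∀ x (x≉0 : ¬ x ≈ 0#) → x * inverse x x≉0 ≈ 1#
  *-inverseʳ x x≉0 = proj₂ (proj₂ isField x x≉0)

  *-inverseˡ : ∀ x (x≉0 : ¬ x ≈ 0#) → inverse x x≉0 * x ≈ 1#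
  *-inverseˡ x x≉0 = trans (*-comm _ x) (*-inverseʳ x x≉0)

  inverse-nonZero : ∀ x (x≉0 : ¬ x ≈ 0#) → ¬ inverse x x≉0 ≈ 0#
  inverse-nonZero x x≉0 x⁻¹≈0 = 0≉1 (begin
    0#                  ≈⟨ zeroʳ x ⟨
    x * 0#              ≈⟨ *-congˡ x⁻¹≈0 ⟨
    x * inverse x x≉0   ≈⟨ *-inverseʳ x x≉0 ⟩
    1#                  ∎)

  *-cancelˡ-nonZero : ∀ {x y z} → ¬ x ≈ 0# → x * y ≈ x * z → y ≈ z
  *-cancelˡ-nonZero {x} {y} {z} x≉0 xy≈xz = begin
    y                            ≈⟨ *-identityˡ y ⟨
    1# * y                       ≈⟨ *-congʳ (*-inverseˡ x x≉0) ⟨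
    (inverse x x≉0 * x) * y      ≈⟨ *-assoc _ _ _ ⟩
    inverse x x≉0 * (x * y)      ≈⟨ *-congˡ xy≈xz ⟩
    inverse x x≉0 * (x * z)      ≈⟨ *-assoc _ _ _ ⟨
    (inverse x x≉0 * x) * z      ≈⟨ *-congʳ (*-inverseˡ x x≉0) ⟩
    1# * z                       ≈⟨ *-identityˡ z ⟩
    z                            ∎

  *-cancelʳ-nonZero : ∀ {x y z} → ¬ x ≈ 0# → y * x ≈ z * x → y ≈ z
  *-cancelʳ-nonZero x≉0 yx≈zx = *-cancelˡ-nonZero x≉0 (trans (*-comm _ _) (trans yx≈zx (*-comm _ _)))

  x≉0∧x*y≈0⇒y≈0 : ∀ {x y} → ¬ x ≈ 0# → x * y ≈ 0# → y ≈ 0#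
  x≉0∧x*y≈0⇒y≈0 {x} x≉0 xy≈0 = *-cancelˡ-nonZero x≉0 (trans xy≈0 (sym (zeroʳ x)))

  *-nonZero : ∀ {x y} → ¬ x ≈ 0# → ¬ y ≈ 0# → ¬ x * y ≈ 0#
  *-nonZero x≉0 y≉0 xy≈0 = y≉0 (x≉0∧x*y≈0⇒y≈0 x≉0 xy≈0)

  ^-nonZero : ∀ {x} n → ¬ x ≈ 0# → ¬ x ^ n ≈ 0#
  ^-nonZero zero    x≉0 1≈0 = 0≉1 (sym 1≈0)
  ^-nonZero (suc n) x≉0     = *-nonZero x≉0 (^-nonZero n x≉0)

  x*z≈y*z∧x≉y⇒z≈0 : ∀ {x y z} → x * z ≈ y * z → ¬ x ≈ y → z ≈ 0#
  x*z≈y*z∧x≉y⇒z≈0 {x} {y} {z} xz≈yz x≉y = x≉0∧x*y≈0⇒y≈0 (x≉y ∘ x∙y⁻¹≈ε⇒x≈y x y) (begin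
    (x - y) * z       ≈⟨ distribʳ z x (- y) ⟩
    x * z + - y * z   ≈⟨ +-congˡ (-‿distribˡ-* y z) ⟨
    x * z - y * z     ≈⟨ x≈y⇒x∙y⁻¹≈ε xz≈yz ⟩
    0#                ∎)

  product-nonZero : ∀ {n} (f : Fin n → Carrier) → (∀ i → ¬ f i ≈ 0#) → ¬ product f ≈ 0#
  product-nonZero {zero}  f _      1≈0 = 0≉1 (sym 1≈0)
  product-nonZero {suc n} f f≉0 = *-nonZero (f≉0 Fin.zero) (product-nonZero (f ∘ Fin.suc) (f≉0 ∘ Fin.suc))

  ·1-homo-^ : ∀ a m → (a ℕ.^ m) · 1# ≈ (a · 1#) ^ m
  ·1-homo-^ a zero    = +-identityʳ 1#
  ·1-homo-^ a (suc m) = trans (×1-homo-* a (a ℕ.^ m)) (*-congˡ (·1-homo-^ a m))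

  0^n≈0 : ∀ {n} → 0 < n → 0# ^ n ≈ 0#
  0^n≈0 {suc n} _ = zeroˡ _

  1^n≈1 : ∀ n → 1# ^ n ≈ 1#
  1^n≈1 zero    = refl
  1^n≈1 (suc n) = trans (*-identityˡ _) (1^n≈1 n)

  -- (c₀ , … , c_{d-1}) stands for the monic polynomial c₀ + c₁ X + ⋯ + c_{d-1} X^{d-1} + X^d.
  evalMonic : ∀ {d} → Vec Carrier d → Carrier → Carrier
  evalMonic []       x = 1#
  evalMonic (c ∷ cs) x = c + x * evalMonic cs x

  divideByRoot : ∀ {d} → Carrier → Vec Carrier (suc d) → Vec Carrier d
  divideByRoot r (c ∷ [])      = []
  divideByRoot r (c ∷ c′ ∷ cs) = evalMonic (c′ ∷ cs) r ∷ divideByRoot r (c′ ∷ cs)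

  -- With Q = divideByRoot r P: P(x) - P(r) = (x - r) Q(x), stated without subtraction so that
  -- the semiring solver applies.
  evalMonic-divideByRoot : ∀ {d} r (P : Vec Carrier (suc d)) x →
    evalMonic P x + r * evalMonic (divideByRoot r P) x ≈ x * evalMonic (divideByRoot r P) x + evalMonic P r
  evalMonic-divideByRoot r (c ∷ []) x =
    solve 3 (λ c x r → c :+ x :* con 1 :+ r :* con 1 := x :* con 1 :+ (c :+ r :* con 1)) refl c x r
  evalMonic-divideByRoot r (c ∷ c′ ∷ cs) x = begin
    c + x * P x + r * (P r + x * Q x) ≈⟨ solve 6 (λ c x r Px Pr Qx →
                                          c :+ x :* Px :+ r :* (Pr :+ x :* Qx) := c :+ x :* (Px :+ r :* Qx) :+ r :* Pr)
                                          refl c x r (P x) (P r) (Q x) ⟩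
    c + x * (P x + r * Q x) + r * P r ≈⟨ +-congʳ (+-congˡ (*-congˡ (evalMonic-divideByRoot r (c′ ∷ cs) x))) ⟩
    c + x * (x * Q x + P r) + r * P r ≈⟨ solve 6 (λ c x r Px Pr Qx →
                                          c :+ x :* (x :* Qx :+ Pr) :+ r :* Pr := x :* (Pr :+ x :* Qx) :+ (c :+ r :* Pr))
                                          refl c x r (P x) (P r) (Q x) ⟩
    x * (P r + x * Q x) + (c + r * P r) ∎
    where
    P Q : Carrier → Carrier
    P = evalMonic (c′ ∷ cs)
    Q = evalMonic (divideByRoot r (c′ ∷ cs))

  monic-roots-bound : ∀ d (P : Vec Carrier d) (G : Fin (suc d) → Carrier) →
    (∀ i j → G i ≈ G j → i ≡ j) → ¬ (∀ i → evalMonic P (G i) ≈ 0#)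
  monic-roots-bound zero    [] G _     roots = 0≉1 (sym (roots Fin.zero))
  monic-roots-bound (suc d) P  G G-inj roots =
    monic-roots-bound d (divideByRoot r P) (G ∘ Fin.suc) (λ i j → Finₚ.suc-injective ∘ G-inj _ _) quotient-roots
    where
    r : Carrier
    r = G Fin.zero
    quotient-roots : ∀ i → evalMonic (divideByRoot r P) (G (Fin.suc i)) ≈ 0#
    quotient-roots i = x*z≈y*z∧x≉y⇒z≈0 rQ≈xQ (λ r≈x → Finₚ.0≢1+n (G-inj _ _ r≈x))
      where
      x Q : Carrier
      x = G (Fin.suc i)
      Q = evalMonic (divideByRoot r P) x
      rQ≈xQ : r * Q ≈ x * Q
      rQ≈xQ = begin
        r * Q                 ≈⟨ +-identityˡ _ ⟨
        0# + r * Q            ≈⟨ +-congʳ (roots (Fin.suc i)) ⟨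
        evalMonic P x + r * Q ≈⟨ evalMonic-divideByRoot r P x ⟩
        x * Q + evalMonic P r ≈⟨ +-congˡ (roots Fin.zero) ⟩
        x * Q + 0#            ≈⟨ +-identityʳ _ ⟩
        x * Q                 ∎

  evalMonic-replicate-0 : ∀ m x → evalMonic (replicate m 0#) x ≈ x ^ m
  evalMonic-replicate-0 zero    x = refl
  evalMonic-replicate-0 (suc m) x = trans (+-identityˡ _) (*-congˡ (evalMonic-replicate-0 m x))

  module Finite {N} (card : HasCardinality R N) where
    private
      e : Fin N → Carrier
      e = proj₁ card
      index : Carrier → Fin N
      index x = proj₁ (proj₂ (proj₂ card) x)
      e∘index : ∀ x → e (index x) ≈ x
      e∘index x = proj₂ (proj₂ (proj₂ card) x)

    enumeration : IsEnumerationOf setoid (λ _ → ⊤) e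
    enumeration = record
      { injective = proj₁ (proj₂ card)
      ; into      = λ _ → tt
      ; onto      = λ x _ → index x , e∘index x
      }

    open IsEnumerationOf enumeration using (injective)

    index-injective : ∀ {x y} → index x ≡ index y → x ≈ y
    index-injective {x} {y} ix≡iy = trans (sym (e∘index x)) (trans (reflexive (≡.cong e ix≡iy)) (e∘index y))

    infix 4 _≟_
    _≟_ : ∀ x y → Dec (x ≈ y)
    x ≟ y with index x Finₚ.≟ index y
    ... | yes ix≡iy = yes (index-injective ix≡iy)
    ... | no  ix≢iy = no (λ x≈y → ix≢iy (injective _ _ (trans (e∘index x) (trans x≈y (sym (e∘index y))))))

    ¬∀⇒∃¬ : ∀ {p} (P : Pred Carrier p) → P Respects _≈_ → Decidable P → ¬ (∀ x → P x) → ∃ λ x → ¬ P x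
    ¬∀⇒∃¬ P P-resp P? ¬∀P = map e id (Finₚ.¬∀⟶∃¬ N (P ∘ e) (P? ∘ e) ¬∀P∘e)
      where
      ¬∀P∘e : ¬ (∀ i → P (e i))
      ¬∀P∘e ∀P∘e = ¬∀P (λ x → P-resp (e∘index x) (∀P∘e (index x)))

    injective⇒surjective : ∀ {φ : Carrier → Carrier} → (∀ {x y} → x ≈ y → φ x ≈ φ y) →
      (∀ x y → φ x ≈ φ y → x ≈ y) → ∀ y → ∃[ x ] φ x ≈ y
    injective⇒surjective {φ} φ-cong φ-injective y =
      e i , index-injective h[i]≡index[y]
      where
      h : Fin N → Fin N
      h i = index (φ (e i))
      h-injective : ∀ {i j} → h i ≡ h j → i ≡ j
      h-injective {i} {j} hi≡hj = injective i j (φ-injective _ _ (index-injective hi≡hj))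
      i : Fin N
      i = proj₁ (Fin-injective⇒surjective h h-injective (index y))
      h[i]≡index[y] : h i ≡ index y
      h[i]≡index[y] = proj₂ (Fin-injective⇒surjective h h-injective (index y))

    translation : IsBijectionOn setoid (λ _ → ⊤) (_+ 1#) (_+ - 1#)
    translation = record
      { φ-cong = +-congʳ ; ψ-cong = +-congʳ ; φ-into = id ; ψ-into = id
      ; ψ∘φ = λ {x} _ → trans (+-assoc x 1# (- 1#)) (trans (+-congˡ (-‿inverseʳ 1#)) (+-identityʳ x))
      ; φ∘ψ = λ {x} _ → trans (+-assoc x (- 1#) 1#) (trans (+-congˡ (-‿inverseˡ 1#)) (+-identityʳ x))
      }

    -- x ↦ x + 1 permutes the field, so Σ (x + 1) = Σ x.
    N·1≈0 : N · 1# ≈ 0#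
    N·1≈0 = +-cancelˡ (sum e) _ _ (begin
      sum e + N · 1#             ≈⟨ +-congˡ (sum-replicate N) ⟨
      sum e + sum {N} (λ _ → 1#) ≈⟨ ∑-distrib-+ e (λ _ → 1#) ⟨
      sum (λ i → e i + 1#)       ≈⟨ sum-invariant-under-bijection +-commutativeMonoid enumeration translation ⟨
      sum e                      ≈⟨ +-identityʳ _ ⟨
      sum e + 0#                 ∎)

    ^≈0⇒≈0 : ∀ {x} m → x ^ m ≈ 0# → x ≈ 0#
    ^≈0⇒≈0 {x} m x^m≈0 with x ≟ 0#
    ... | yes x≈0 = x≈0
    ... | no  x≉0 = contradiction x^m≈0 (^-nonZero m x≉0)

    N≡p^m⇒p·1≈0 : ∀ {p m} → N ≡ p ℕ.^ m → p · 1# ≈ 0#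
    N≡p^m⇒p·1≈0 {p} {m} N≡p^m = ^≈0⇒≈0 m (begin
      (p · 1#) ^ m     ≈⟨ ·1-homo-^ p m ⟨
      (p ℕ.^ m) · 1#   ≡⟨ ≡.cong (_· 1#) N≡p^m ⟨
      N · 1#           ≈⟨ N·1≈0 ⟩
      0#               ∎)

    private
      M : ℕ
      M = ℕ.pred N
      N≡1+M : N ≡ suc M
      N≡1+M = ≡.sym (ℕₚ.suc-pred N {{Finₚ.nonZeroIndex (index 0#)}})

    scaling : ∀ {a} (a≉0 : ¬ a ≈ 0#) → IsBijectionOn setoid (λ x → ¬ x ≈ 0#) (a *_) (inverse a a≉0 *_)
    scaling {a} a≉0 = record
      { φ-cong = *-congˡ ; ψ-cong = *-congˡ
      ; φ-into = *-nonZero a≉0 ; ψ-into = *-nonZero (inverse-nonZero a a≉0)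
      ; ψ∘φ = λ {x} _ → trans (sym (*-assoc _ a x)) (trans (*-congʳ (*-inverseˡ a a≉0)) (*-identityˡ x))
      ; φ∘ψ = λ {x} _ → trans (sym (*-assoc a _ x)) (trans (*-congʳ (*-inverseʳ a a≉0)) (*-identityˡ x))
      }

    -- Multiplying by a permutes the nonzero elements, so it does not change their product.
    fermat-nonZero : ∀ {a} → ¬ a ≈ 0# → a ^ ℕ.pred N ≈ 1#
    fermat-nonZero {a} a≉0 = sym (*-cancelʳ-nonZero (product-nonZero E E-into) (begin
      1# * product E                ≈⟨ *-identityˡ _ ⟩
      product E                     ≈⟨ sum-invariant-under-bijection *-commutativeMonoid E-enum (scaling a≉0) ⟩
      product (λ j → a * E j)       ≈⟨ ∏-distrib-* (λ _ → a) E ⟩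
      product {M} (λ _ → a) * product E ≈⟨ *-congʳ (product-replicate M) ⟩
      a ^ M * product E                 ∎))
      where
      nonZero-enumeration : Σ (Fin M → Carrier) (IsEnumerationOf setoid (λ x → ¬ x ≈ 0#))
      nonZero-enumeration = remove-from-enumeration setoid
        (≡.subst (TotalEnumeration setoid) N≡1+M (e , enumeration)) 0#
      E : Fin M → Carrier
      E = proj₁ nonZero-enumeration
      E-enum : IsEnumerationOf setoid (λ x → ¬ x ≈ 0#) E
      E-enum = proj₂ nonZero-enumeration
      E-into : ∀ j → ¬ E j ≈ 0#
      E-into = IsEnumerationOf.into E-enum

    fermat : ∀ x → x ^ N ≈ x
    fermat x = begin
      x ^ N      ≡⟨ ≡.cong (x ^_) N≡1+M ⟩
      x * x ^ M  ≈⟨ x*x^M≈x ⟩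
      x          ∎
      where
      x*x^M≈x : x * x ^ M ≈ x
      x*x^M≈x with x ≟ 0#
      ... | yes x≈0 = trans (*-congʳ x≈0) (trans (zeroˡ _) (sym x≈0))
      ... | no  x≉0 = trans (*-congˡ (fermat-nonZero x≉0)) (*-identityʳ x)

    ¬∀x^m≈x : ∀ {m} → 2 ≤ m → m < N → ¬ (∀ x → x ^ m ≈ x)
    ¬∀x^m≈x {suc zero}    (s≤s ())
    ¬∀x^m≈x {suc (suc m)} _ m<N ∀x^m≈x =
      monic-roots-bound _ (0# ∷ - 1# ∷ replicate m 0#) (e ∘ (λ i → Fin.inject≤ i m<N))
        (λ i j → Finₚ.inject≤-injective m<N m<N i j ∘ injective _ _) root
      where
      root : ∀ i → evalMonic (0# ∷ - 1# ∷ replicate m 0#) (e (Fin.inject≤ i m<N)) ≈ 0#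
      root i = begin
        0# + x * (- 1# + x * evalMonic (replicate m 0#) x) ≈⟨ +-identityˡ _ ⟩
        x * (- 1# + x * evalMonic (replicate m 0#) x)      ≈⟨ *-congˡ (+-congˡ (*-congˡ (evalMonic-replicate-0 m x))) ⟩
        x * (- 1# + x ^ suc m)                             ≈⟨ distribˡ x (- 1#) _ ⟩
        x * - 1# + x ^ suc (suc m)                         ≈⟨ +-congˡ (trans (∀x^m≈x x) (sym (*-identityʳ x))) ⟩
        x * - 1# + x * 1#                                  ≈⟨ distribˡ x (- 1#) 1# ⟨
        x * (- 1# + 1#)                                    ≈⟨ *-congˡ (-‿inverseˡ 1#) ⟩
        x * 0#                                             ≈⟨ zeroʳ x ⟩
        0#                                                 ∎
        where
        x : Carrier
        x = e (Fin.inject≤ i m<N)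

module QFrobenius {c ℓ} (R : CommutativeRing c ℓ) (isField : IsField R) {q : ℕ}
                  (card : HasCardinality R (q ℕ.^ 3)) {p k : ℕ}
                  (p-prime : Prime p) (k≥1 : 1 ≤ k) (q≡p^k : q ≡ p ℕ.^ k) where
  open CommutativeRing R
  open Field R isField
  open Finite card
  open import Algebra.Properties.Ring ring using (+-inverseˡ-unique)
  open import Algebra.Properties.Semiring.Exp semiring
  open import Algebra.Properties.CommutativeSemiring.Exp commutativeSemiring using (^-distrib-*)
  open import Algebra.Properties.Semiring.Mult semiring using () renaming (_×_ to _·_)
  open import Relation.Binary.Reasoning.Setoid setoid

  q≥2 : 2 ≤ q
  q≥2 = ≡.subst (2 ≤_) (≡.sym q≡p^k) (ℕₚ.≤-trans p≥2 (ℕₚ.≤-trans p≤p^1 (ℕₚ.^-monoʳ-≤ p k≥1)))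
    where
    instance
      p-nonZero : ℕ.NonZero p
      p-nonZero = prime⇒nonZero p-prime
    p≥2 : 2 ≤ p
    p≥2 = ℕ.nonTrivial⇒n>1 p {{prime⇒nonTrivial p-prime}}
    p≤p^1 : p ≤ p ℕ.^ 1
    p≤p^1 = ℕₚ.≤-reflexive (≡.sym (ℕₚ.*-identityʳ p))

  instance
    q-nonZero : ℕ.NonZero q
    q-nonZero = ℕ.>-nonZero (ℕₚ.<-trans (s≤s z≤n) q≥2)

  q<q^3 : q < q ℕ.^ 3
  q<q^3 = ℕₚ.m<m*n q (q ℕ.* (q ℕ.* 1)) (ℕₚ.<-≤-trans q≥2 (ℕₚ.m≤m*n q (q ℕ.* 1) {{ℕₚ.m*n≢0 q 1}}))

  σ : Carrier → Carrier
  σ x = x ^ q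

  σ-cong : ∀ {x y} → x ≈ y → σ x ≈ σ y
  σ-cong = ^-congˡ q

  σ-+ : ∀ x y → σ (x + y) ≈ σ x + σ y
  σ-+ x y = ≡.subst (λ n → (x + y) ^ n ≈ x ^ n + y ^ n) (≡.sym q≡p^k) (^[p^k]-distrib-+ p-prime p·1≈0 k x y)
    where
    open Frobenius commutativeSemiring using (^[p^k]-distrib-+)
    p·1≈0 : p · 1# ≈ 0#
    p·1≈0 = N≡p^m⇒p·1≈0 {p} {k ℕ.* 3} (≡.trans (≡.cong (ℕ._^ 3) q≡p^k) (ℕₚ.^-*-assoc p k 3))

  σ-* : ∀ x y → σ (x * y) ≈ σ x * σ y
  σ-* x y = ^-distrib-* x y q

  σ-0 : σ 0# ≈ 0#
  σ-0 = 0^n≈0 (ℕ.>-nonZero⁻¹ q)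

  σ-1 : σ 1# ≈ 1#
  σ-1 = 1^n≈1 q

  σ-nonZero : ∀ {x} → ¬ x ≈ 0# → ¬ σ x ≈ 0#
  σ-nonZero = ^-nonZero q

  σ-‿ : ∀ x → σ (- x) ≈ - σ x
  σ-‿ x = +-inverseˡ-unique (σ (- x)) (σ x) (begin
    σ (- x) + σ x  ≈⟨ σ-+ (- x) x ⟨
    σ (- x + x)    ≈⟨ σ-cong (-‿inverseˡ x) ⟩
    σ 0#           ≈⟨ σ-0 ⟩
    0#             ∎)

  ^[q*q]≈σσ : ∀ x → x ^ (q ℕ.* q) ≈ σ (σ x)
  ^[q*q]≈σσ x = sym (^-assocʳ x q q)

  σ³≈id : ∀ x → σ (σ (σ x)) ≈ x
  σ³≈id x = begin
    σ (σ (σ x))          ≈⟨ σ-cong (^-assocʳ x q q) ⟩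
    (x ^ (q ℕ.* q)) ^ q  ≈⟨ ^-assocʳ x (q ℕ.* q) q ⟩
    x ^ (q ℕ.* q ℕ.* q)  ≡⟨ ≡.cong (x ^_) q*q*q≡q^3 ⟩
    x ^ (q ℕ.^ 3)        ≈⟨ fermat x ⟩
    x                    ∎
    where
    q*q*q≡q^3 : q ℕ.* q ℕ.* q ≡ q ℕ.^ 3
    q*q*q≡q^3 = ≡.trans (ℕₚ.*-assoc q q q) (≡.cong (λ n → q ℕ.* (q ℕ.* n)) (≡.sym (ℕₚ.*-identityʳ q)))

module Trinomial {c ℓ} (R : CommutativeRing c ℓ) (isField : IsField R) {q : ℕ}
                 (card : HasCardinality R (q ℕ.^ 3)) {p k : ℕ}
                 (p-prime : Prime p) (k≥1 : 1 ≤ k) (q≡p^k : q ≡ p ℕ.^ k)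
                 (A : CommutativeRing.Carrier R) (A^q≈A : CommutativeRing._≈_ R (Defs._^_ R A q) A) where
  open CommutativeRing R
  open Field R isField
  open Finite card
  open QFrobenius R isField card p-prime k≥1 q≡p^k
  open import Algebra.Properties.Ring ring using (+-cancelʳ)
  open import Algebra.Properties.Semiring.Exp semiring
  open import Algebra.Solver.Ring.NaturalCoefficients.Default commutativeSemiring
  open import Relation.Binary.Reasoning.Setoid setoid

  f g : Carrier → Carrier
  f = f₃ R q A
  g = g₃ R q A

  q²-q+1 : ℕ
  q²-q+1 = (q ℕ.* q ∸ q) ℕ.+ 1

  f-cong : ∀ {x y} → x ≈ y → f x ≈ f y
  f-cong x≈y = +-cong (+-cong x≈y (*-congˡ (^-congˡ q²-q+1 x≈y))) (*-congˡ (^-congˡ (q ℕ.* q) x≈y))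

  g-cong : ∀ {x y} → x ≈ y → g x ≈ g y
  g-cong x≈y =
    *-cong (^-congˡ (q ℕ.^ 3 ∸ 2) (+-cong (+-cong (*-congˡ x≈y) (σ-cong x≈y)) (*-congˡ (^-congˡ (q ℕ.* q) x≈y))))
           (^-congˡ (q ℕ.+ 1) x≈y)

  f-0 : f 0# ≈ 0#
  f-0 = begin
    0# + A * 0# ^ q²-q+1 + A ^ 2 * 0# ^ (q ℕ.* q)
      ≈⟨ +-cong (+-congˡ (*-congˡ (0^n≈0 {q²-q+1} (ℕₚ.m≤n+m 1 _))))
                (*-congˡ (0^n≈0 (ℕₚ.<-≤-trans (ℕ.>-nonZero⁻¹ q) (ℕₚ.m≤m*n q q)))) ⟩
    0# + A * 0# + A ^ 2 * 0#
      ≈⟨ +-cong (trans (+-identityˡ _) (zeroʳ A)) (zeroʳ _) ⟩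
    0# + 0#
      ≈⟨ +-identityʳ 0# ⟩
    0# ∎

  g-0 : g 0# ≈ 0#
  g-0 = trans (*-congˡ (0^n≈0 (ℕₚ.m≤n+m 1 q))) (zeroʳ _)

  S : Carrier → Carrier → Carrier → Carrier
  S a b c = a * b + A * (a * c) + A * A * (b * c)

  L : Carrier → Carrier
  L y = A * A * y + σ y + A * σ (σ y)

  A^2≈A*A : A ^ 2 ≈ A * A
  A^2≈A*A = *-congˡ (*-identityʳ A)

  A^3≈A*A*A : A ^ 3 ≈ A * A * A
  A^3≈A*A*A = trans (*-congˡ (*-congˡ (*-identityʳ A))) (sym (*-assoc A A A))

  S-cong : ∀ {a a′ b b′ c c′} → a ≈ a′ → b ≈ b′ → c ≈ c′ → S a b c ≈ S a′ b′ c′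
  S-cong a≈ b≈ c≈ = +-cong (+-cong (*-cong a≈ b≈) (*-congˡ (*-cong a≈ c≈))) (*-congˡ (*-cong b≈ c≈))

  σ-S : ∀ a b c → σ (S a b c) ≈ S (σ a) (σ b) (σ c)
  σ-S a b c = begin
    σ (a * b + A * (a * c) + A * A * (b * c))
      ≈⟨ trans (σ-+ _ _) (+-congʳ (σ-+ _ _)) ⟩
    σ (a * b) + σ (A * (a * c)) + σ (A * A * (b * c))
      ≈⟨ +-cong (+-cong (σ-* a b) (trans (σ-* _ _) (*-cong A^q≈A (σ-* a c))))
                (trans (σ-* _ _) (*-cong (trans (σ-* A A) (*-cong A^q≈A A^q≈A)) (σ-* b c))) ⟩
    S (σ a) (σ b) (σ c) ∎

  σ-rotate : ∀ {u v a b c} → u * v ≈ S a b c → σ u * σ v ≈ S (σ a) (σ b) (σ c)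
  σ-rotate {u} {v} uv≈S = trans (sym (σ-* u v)) (trans (σ-cong uv≈S) (σ-S _ _ _))

  q²-q+1+q≡1+q² : q²-q+1 ℕ.+ q ≡ suc (q ℕ.* q)
  q²-q+1+q≡1+q² = ≡.trans (ℕₚ.+-assoc (q ℕ.* q ∸ q) 1 q)
    (≡.trans (ℕₚ.+-suc (q ℕ.* q ∸ q) q) (≡.cong suc (ℕₚ.m∸n+n≡m (ℕₚ.m≤m*n q q))))

  f*σ≈S : ∀ x → f x * σ x ≈ S x (σ x) (σ (σ x))
  f*σ≈S x = begin
    (x + A * x ^ q²-q+1 + A ^ 2 * x ^ (q ℕ.* q)) * σ x
      ≈⟨ solve 6 (λ x A A² xᵉ xᵠ² σx → (x :+ A :* xᵉ :+ A² :* xᵠ²) :* σx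
                                     := x :* σx :+ A :* (xᵉ :* σx) :+ A² :* (σx :* xᵠ²))
               refl x A (A ^ 2) (x ^ q²-q+1) (x ^ (q ℕ.* q)) (σ x) ⟩
    x * σ x + A * (x ^ q²-q+1 * σ x) + A ^ 2 * (σ x * x ^ (q ℕ.* q))
      ≈⟨ +-cong (+-congˡ (*-congˡ x^[q²-q+1]*σx≈x*σσx)) (*-cong A^2≈A*A (*-congˡ (^[q*q]≈σσ x))) ⟩
    S x (σ x) (σ (σ x)) ∎
    where
    x^[q²-q+1]*σx≈x*σσx : x ^ q²-q+1 * σ x ≈ x * σ (σ x)
    x^[q²-q+1]*σx≈x*σσx = begin
      x ^ q²-q+1 * σ x       ≈⟨ ^-homo-* x q²-q+1 q ⟨
      x ^ (q²-q+1 ℕ.+ q)      ≡⟨ ≡.cong (x ^_) q²-q+1+q≡1+q² ⟩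
      x * x ^ (q ℕ.* q)   ≈⟨ *-congˡ (^[q*q]≈σσ x) ⟩
      x * σ (σ x)         ∎

  σf*σσ≈S : ∀ x → σ (f x) * σ (σ x) ≈ S (σ x) (σ (σ x)) x
  σf*σσ≈S x = trans (σ-rotate (f*σ≈S x)) (S-cong refl refl (σ³≈id x))

  σσf*x≈S : ∀ x → σ (σ (f x)) * x ≈ S (σ (σ x)) x (σ x)
  σσf*x≈S x = trans (*-congˡ (sym (σ³≈id x))) (trans (σ-rotate (σf*σσ≈S x)) (S-cong refl (σ³≈id x) refl))

  S-product : ∀ a b c → S a b c * S b c a ≈ A * A * S a b c * (a * c) + S b c a * (a * b) + A * S c a b * (b * c)
  S-product = solve 4 (λ A a b c →
    let S′ = λ a b c → a :* b :+ A :* (a :* c) :+ A :* A :* (b :* c) in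
    S′ a b c :* S′ b c a := A :* A :* S′ a b c :* (a :* c) :+ S′ b c a :* (a :* b) :+ A :* S′ c a b :* (b :* c)) refl A

  f*σf≈x*L : ∀ {x} → ¬ x ≈ 0# → f x * σ (f x) ≈ x * L (f x)
  f*σf≈x*L {x} x≉0 = *-cancelʳ-nonZero (*-nonZero (σ-nonZero x≉0) (σ-nonZero (σ-nonZero x≉0))) (begin
    (y * y₁) * (x₁ * x₂)
      ≈⟨ solve 4 (λ y y₁ x₁ x₂ → (y :* y₁) :* (x₁ :* x₂) := (y :* x₁) :* (y₁ :* x₂)) refl y y₁ x₁ x₂ ⟩
    (y * x₁) * (y₁ * x₂)
      ≈⟨ *-cong (f*σ≈S x) (σf*σσ≈S x) ⟩
    S x x₁ x₂ * S x₁ x₂ x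
      ≈⟨ S-product x x₁ x₂ ⟩
    A * A * S x x₁ x₂ * (x * x₂) + S x₁ x₂ x * (x * x₁) + A * S x₂ x x₁ * (x₁ * x₂)
      ≈⟨ +-cong (+-cong (*-congʳ (*-congˡ (f*σ≈S x))) (*-congʳ (σf*σσ≈S x)))
                (*-congʳ (*-congˡ (σσf*x≈S x))) ⟨
    A * A * (y * x₁) * (x * x₂) + (y₁ * x₂) * (x * x₁) + A * (y₂ * x) * (x₁ * x₂)
      ≈⟨ solve 7 (λ A x x₁ x₂ y y₁ y₂ →
           A :* A :* (y :* x₁) :* (x :* x₂) :+ (y₁ :* x₂) :* (x :* x₁) :+ A :* (y₂ :* x) :* (x₁ :* x₂)
           := (x :* (A :* A :* y :+ y₁ :+ A :* y₂)) :* (x₁ :* x₂)) refl A x x₁ x₂ y y₁ y₂ ⟩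
    (x * L y) * (x₁ * x₂) ∎)
    where
    y x₁ x₂ y₁ y₂ : Carrier
    y = f x
    x₁ = σ x
    x₂ = σ x₁
    y₁ = σ y
    y₂ = σ y₁

  g≈L^[N∸2]*y*σy : ∀ y → g y ≈ L y ^ (q ℕ.^ 3 ∸ 2) * (y * σ y)
  g≈L^[N∸2]*y*σy y =
    *-cong (^-congˡ (q ℕ.^ 3 ∸ 2) (+-cong (+-congʳ (*-congʳ A^2≈A*A)) (*-congˡ (^[q*q]≈σσ y))))
           (reflexive (≡.cong (y ^_) (ℕₚ.+-comm q 1)))

  -- A S(a,b,c) - S(b,c,a) = (A³ - 1) b c, with the negative terms moved across.
  S-rotation-difference : ∀ a b c → A * S a b c + b * c ≈ S b c a + A * A * A * (b * c)
  S-rotation-difference = solve 4 (λ A a b c →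
    let S′ = λ a b c → a :* b :+ A :* (a :* c) :+ A :* A :* (b :* c) in
    A :* S′ a b c :+ b :* c := S′ b c a :+ A :* A :* A :* (b :* c)) refl A

  zero-of-f⇒A³≈1 : ∀ {x} → ¬ x ≈ 0# → f x ≈ 0# → A ^ 3 ≈ 1#
  zero-of-f⇒A³≈1 {x} x≉0 fx≈0 = trans A^3≈A*A*A (sym (*-cancelʳ-nonZero x₁x₂≉0 (begin
    1# * (x₁ * x₂)              ≈⟨ *-identityˡ _ ⟩
    x₁ * x₂                     ≈⟨ +-identityˡ _ ⟨
    0# + x₁ * x₂                ≈⟨ +-congʳ (trans (*-congˡ S₀≈0) (zeroʳ A)) ⟨
    A * S x x₁ x₂ + x₁ * x₂     ≈⟨ S-rotation-difference x x₁ x₂ ⟩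
    S x₁ x₂ x + A * A * A * (x₁ * x₂) ≈⟨ +-congʳ S₁≈0 ⟩
    0# + A * A * A * (x₁ * x₂)  ≈⟨ +-identityˡ _ ⟩
    A * A * A * (x₁ * x₂)       ∎)))
    where
    x₁ x₂ : Carrier
    x₁ = σ x
    x₂ = σ x₁
    x₁x₂≉0 : ¬ x₁ * x₂ ≈ 0#
    x₁x₂≉0 = *-nonZero (σ-nonZero x≉0) (σ-nonZero (σ-nonZero x≉0))
    S₀≈0 : S x x₁ x₂ ≈ 0#
    S₀≈0 = trans (sym (f*σ≈S x)) (trans (*-congʳ fx≈0) (zeroˡ _))
    S₁≈0 : S x₁ x₂ x ≈ 0#
    S₁≈0 = trans (sym (σf*σσ≈S x)) (trans (*-congʳ (trans (σ-cong fx≈0) σ-0)) (zeroˡ _))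

  g∘f≈id : ¬ A ^ 3 ≈ 1# → ∀ x → g (f x) ≈ x
  g∘f≈id A³≉1 x with x ≟ 0#
  ... | yes x≈0 = trans (g-cong (trans (f-cong x≈0) f-0)) (trans g-0 (sym x≈0))
  ... | no  x≉0 = begin
    g y                                  ≈⟨ g≈L^[N∸2]*y*σy y ⟩
    L y ^ (q ℕ.^ 3 ∸ 2) * (y * σ y)      ≈⟨ *-congˡ (f*σf≈x*L x≉0) ⟩
    L y ^ (q ℕ.^ 3 ∸ 2) * (x * L y)      ≈⟨ solve 3 (λ a x l → a :* (x :* l) := x :* (l :* a)) refl _ x (L y) ⟩
    x * L y ^ suc (q ℕ.^ 3 ∸ 2)          ≡⟨ ≡.cong (λ n → x * L y ^ n) 1+[N∸2]≡N∸1 ⟩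
    x * L y ^ ℕ.pred (q ℕ.^ 3)           ≈⟨ *-congˡ (fermat-nonZero Ly≉0) ⟩
    x * 1#                               ≈⟨ *-identityʳ x ⟩
    x                                    ∎
    where
    y : Carrier
    y = f x
    y≉0 : ¬ y ≈ 0#
    y≉0 = A³≉1 ∘ zero-of-f⇒A³≈1 x≉0
    Ly≉0 : ¬ L y ≈ 0#
    Ly≉0 Ly≈0 = *-nonZero y≉0 (σ-nonZero y≉0) (trans (f*σf≈x*L x≉0) (trans (*-congˡ Ly≈0) (zeroʳ x)))
    1+[N∸2]≡N∸1 : suc (q ℕ.^ 3 ∸ 2) ≡ ℕ.pred (q ℕ.^ 3)
    1+[N∸2]≡N∸1 = ≡.sym (ℕₚ.+-∸-assoc 1 (ℕₚ.<-trans q≥2 q<q^3))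

  ∃σw≉Aw : ∃ λ w → ¬ σ w ≈ A * w
  ∃σw≉Aw = ¬∀⇒∃¬ (λ w → σ w ≈ A * w) σw≈Aw-resp (λ w → σ w ≟ A * w) ¬∀σw≈Aw
    where
    σw≈Aw-resp : (λ w → σ w ≈ A * w) Respects _≈_
    σw≈Aw-resp w≈w′ σw≈Aw = trans (σ-cong (sym w≈w′)) (trans σw≈Aw (*-congˡ w≈w′))
    ¬∀σw≈Aw : ¬ (∀ w → σ w ≈ A * w)
    ¬∀σw≈Aw σ≈A* = ¬∀x^m≈x q≥2 q<q^3 (λ x → trans (σ≈A* x) (trans (*-congʳ A≈1) (*-identityˡ x)))
      where
      A≈1 : A ≈ 1#
      A≈1 = trans (sym (*-identityʳ A)) (trans (sym (σ≈A* 1#)) σ-1)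

  twist : Carrier → Carrier
  twist w = σ w + - A * w

  twist-nonZero : ∀ {w} → ¬ σ w ≈ A * w → ¬ twist w ≈ 0#
  twist-nonZero {w} σw≉Aw twist≈0 = σw≉Aw (begin
    σ w                      ≈⟨ +-identityʳ _ ⟨
    σ w + 0#                 ≈⟨ +-congˡ (trans (*-congʳ (-‿inverseˡ A)) (zeroˡ w)) ⟨
    σ w + (- A + A) * w      ≈⟨ solve 4 (λ σw B A w → σw :+ (B :+ A) :* w := (σw :+ B :* w) :+ A :* w)
                                        refl (σ w) (- A) A w ⟩
    twist w + A * w          ≈⟨ +-congʳ twist≈0 ⟩
    0# + A * w               ≈⟨ +-identityˡ _ ⟩
    A * w                    ∎)

  weightedTrace : Carrier → Carrier
  weightedTrace u = A * A * u + A * σ u + σ (σ u)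

  weightedTrace∘twist≈0 : A ^ 3 ≈ 1# → ∀ w → weightedTrace (twist w) ≈ 0#
  weightedTrace∘twist≈0 A³≈1 w = +-cancelʳ w _ _ (begin
    A * A * u + A * σ u + σ (σ u) + w
      ≈⟨ +-cong (+-congˡ σσu≈w+Bσσw) (trans (sym (*-identityˡ w)) (*-congʳ (trans (sym A³≈1) A^3≈A*A*A))) ⟩
    A * A * u + A * σ u + (w + B * σ (σ w)) + A * A * A * w
      ≈⟨ +-congʳ (+-congʳ (+-congˡ (*-congˡ σu≈σσw+Bσw))) ⟩
    A * A * (σ w + B * w) + A * (σ (σ w) + B * σ w) + (w + B * σ (σ w)) + A * A * A * w
      ≈⟨ solve 5 (λ A B w w₁ w₂ →
           A :* A :* (w₁ :+ B :* w) :+ A :* (w₂ :+ B :* w₁) :+ (w :+ B :* w₂) :+ A :* A :* A :* w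
           := (B :+ A) :* (A :* w₁ :+ w₂ :+ A :* A :* w) :+ w) refl A B w (σ w) (σ (σ w)) ⟩
    (B + A) * (A * σ w + σ (σ w) + A * A * w) + w
      ≈⟨ +-congʳ (trans (*-congʳ (-‿inverseˡ A)) (zeroˡ _)) ⟩
    0# + w ∎)
    where
    B u : Carrier
    B = - A
    u = twist w
    σB≈B : σ B ≈ B
    σB≈B = trans (σ-‿ A) (-‿cong A^q≈A)
    σu≈σσw+Bσw : σ u ≈ σ (σ w) + B * σ w
    σu≈σσw+Bσw = trans (σ-+ _ _) (+-congˡ (trans (σ-* B w) (*-congʳ σB≈B)))
    σσu≈w+Bσσw : σ (σ u) ≈ w + B * σ (σ w)
    σσu≈w+Bσσw =
      trans (σ-cong σu≈σσw+Bσw) (trans (σ-+ _ _) (+-cong (σ³≈id w) (trans (σ-* B _) (*-congʳ σB≈B))))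

  S-of-reciprocal : ∀ {x u} → x * u ≈ 1# → S x (σ x) (σ (σ x)) * (u * (σ u * σ (σ u))) ≈ weightedTrace u
  S-of-reciprocal {x} {u} xu≈1 = begin
    S x (σ x) (σ (σ x)) * (u * (σ u * σ (σ u)))
      ≈⟨ solve 7 (λ A x x₁ x₂ u u₁ u₂ →
           (x :* x₁ :+ A :* (x :* x₂) :+ A :* A :* (x₁ :* x₂)) :* (u :* (u₁ :* u₂))
           := (x :* u) :* (x₁ :* u₁) :* u₂ :+ A :* ((x :* u) :* (x₂ :* u₂)) :* u₁ :+ A :* A :* ((x₁ :* u₁) :* (x₂ :* u₂)) :* u)
           refl A x (σ x) (σ (σ x)) u (σ u) (σ (σ u)) ⟩
    (x * u) * (σ x * σ u) * σ (σ u) + A * ((x * u) * (σ (σ x) * σ (σ u))) * σ u + A * A * ((σ x * σ u) * (σ (σ x) * σ (σ u))) * u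
      ≈⟨ +-cong (+-cong (*-congʳ (*-cong xu≈1 σxσu≈1)) (*-congʳ (*-congˡ (*-cong xu≈1 σσxσσu≈1))))
                (*-congʳ (*-congˡ (*-cong σxσu≈1 σσxσσu≈1))) ⟩
    (1# * 1#) * σ (σ u) + A * (1# * 1#) * σ u + A * A * (1# * 1#) * u
      ≈⟨ solve 4 (λ A u u₁ u₂ → (con 1 :* con 1) :* u₂ :+ A :* (con 1 :* con 1) :* u₁ :+ A :* A :* (con 1 :* con 1) :* u
                                := A :* A :* u :+ A :* u₁ :+ u₂) refl A u (σ u) (σ (σ u)) ⟩
    weightedTrace u ∎
    where
    σ-reciprocal : ∀ {a b} → a * b ≈ 1# → σ a * σ b ≈ 1#
    σ-reciprocal ab≈1 = trans (sym (σ-* _ _)) (trans (σ-cong ab≈1) σ-1)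
    σxσu≈1 : σ x * σ u ≈ 1#
    σxσu≈1 = σ-reciprocal xu≈1
    σσxσσu≈1 : σ (σ x) * σ (σ u) ≈ 1#
    σσxσσu≈1 = σ-reciprocal σxσu≈1

  A³≈1⇒zero-of-f : A ^ 3 ≈ 1# → ∃ λ x → ¬ x ≈ 0# × f x ≈ 0#
  A³≈1⇒zero-of-f A³≈1 = x , x≉0 , fx≈0
    where
    u : Carrier
    u = twist (proj₁ ∃σw≉Aw)
    u≉0 : ¬ u ≈ 0#
    u≉0 = twist-nonZero (proj₂ ∃σw≉Aw)
    x : Carrier
    x = inverse u u≉0
    x≉0 : ¬ x ≈ 0#
    x≉0 = inverse-nonZero u u≉0
    S≈0 : S x (σ x) (σ (σ x)) ≈ 0#
    S≈0 = x≉0∧x*y≈0⇒y≈0 (*-nonZero u≉0 (*-nonZero (σ-nonZero u≉0) (σ-nonZero (σ-nonZero u≉0))))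
            (trans (*-comm _ _) (trans (S-of-reciprocal (*-inverseˡ u u≉0)) (weightedTrace∘twist≈0 A³≈1 _)))
    fx≈0 : f x ≈ 0#
    fx≈0 = x≉0∧x*y≈0⇒y≈0 (σ-nonZero x≉0) (trans (*-comm _ _) (trans (f*σ≈S x) S≈0))

  permutation⇒A³≉1 : IsPermutation R f → ¬ A ^ 3 ≈ 1#
  permutation⇒A³≉1 (f-injective , _) A³≈1 =
    let x , x≉0 , fx≈0 = A³≈1⇒zero-of-f A³≈1 in x≉0 (f-injective x 0# (trans fx≈0 (sym f-0)))

  A³≉1⇒permutation : ¬ A ^ 3 ≈ 1# → IsPermutation R f
  A³≉1⇒permutation A³≉1 = f-injective , injective⇒surjective f-cong f-injective
    where
    f-injective : ∀ x y → f x ≈ f y → x ≈ y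
    f-injective x y fx≈fy = trans (sym (g∘f≈id A³≉1 x)) (trans (g-cong fx≈fy) (g∘f≈id A³≉1 y))

  permutation⇒inverse : IsPermutation R f → IsInverse R f g
  permutation⇒inverse perm@(_ , f-surjective) = f∘g≈id , g∘f≈id A³≉1
    where
    A³≉1 : ¬ A ^ 3 ≈ 1#
    A³≉1 = permutation⇒A³≉1 perm
    f∘g≈id : ∀ y → f (g y) ≈ y
    f∘g≈id y = let x , fx≈y = f-surjective y in
      trans (f-cong (g-cong (sym fx≈y))) (trans (f-cong (g∘f≈id A³≉1 x)) fx≈y)

-- Defs._^_ is opened only here: inside the modules above it would clash with the standard library's ring power.
open import Defs using (_^_)

mainTheorem3 : {c ℓ : Level} (R : CommutativeRing c ℓ) (q : ℕ) →
    IsPrimePower q → IsFiniteFieldOfOrder R (q ℕ.^ 3) →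
    (A : CommutativeRing.Carrier R) →
    ¬ (CommutativeRing._≈_ R A (CommutativeRing.0# R)) →
    CommutativeRing._≈_ R (_^_ R A q) A →
    ((IsPermutation R (f₃ R q A) → ¬ (CommutativeRing._≈_ R (_^_ R A 3) (CommutativeRing.1# R)))
      × (¬ (CommutativeRing._≈_ R (_^_ R A 3) (CommutativeRing.1# R)) → IsPermutation R (f₃ R q A)))
    × (IsPermutation R (f₃ R q A) → IsInverse R (f₃ R q A) (g₃ R q A))
mainTheorem3 R q (p , k , p-prime , k≥1 , q≡p^k) (isField , card) A _ A^q≈A =
  (permutation⇒A³≉1 , A³≉1⇒permutation) , permutation⇒inverse
  where
  open Trinomial R isField card p-prime k≥1 q≡p^k A A^q≈A
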